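{- Let $G$ be a finite simple undirected connected graph, $F$ a diagonal matching rule for $G$, and $M$ the prefix matching generated by $F$. If a sequence $(x_0,\ldots,x_k)$ is unmatched, then $d(x_i,x_{i+1})=1$ for all $0\le i\le k-1$. If $(x_0,\ldots,x_k)$ is a sequence with unmatched prefix $(x_0,\ldots,x_{k-1})$ and $F(x_0,\ldots,x_k)=\iota(v)$, then $d(x_{k-1},v)=1$.
   Context: $d$ is the shortest-path metric of $G$, $\ell(x_0,\ldots,x_k)=\sum_{i=0}^{k-1}d(x_i,x_{i+1})$. A "sequence" means a tuple $(x_0,\ldots,x_k)\in V(G)^{k+1}$ ($k\ge 0$) with $x_i\ne x_{i+1}$ for all $i$. Let $\Gamma$ be the directed graph whose vertices are all sequences and with an edge $a\to b$ whenever $a=(x_0,\ldots,x_k)$ and $b=(x_0,\ldots,\hat x_i,\ldots,x_k)$ for some $1\le i\le k-1$ with $\ell(b)=\ell(a)$. A matching is a set of edges of $\Gamma$, no two sharing an endpoint. Relative to a matching, the matching state of a sequence $(x_0,\ldots,x_k)$ is: unmatched; insert$(i,v)$ if it is matched to $(x_0,\ldots,x_i,v,x_{i+1},\ldots,x_k)$; or delete$(i)$ if it is matched to $(x_0,\ldots,\hat x_i,\ldots,x_k)$. A prefix matching is a matching such that: if $(x_0,\ldots,x_k)$ has state insert$(i,v)$ (resp. delete$(i)$), then every sequence of the form $(x_0,\ldots,x_{i+1},y_{i+2},\ldots,y_{k'})$ has state insert$(i,v)$ (resp. delete$(i)$). A matching rule is a function $F$ from finite tuples of vertices to the symbols $\{\epsilon\}\cup\{\iota(v):v\in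 V(G)\}\cup\{\delta\}$. A prefix matching $M$ is generated by $F$ if for every sequence $(x_0,\ldots,x_k)$ ($k\ge1$) whose prefix $(x_0,\ldots,x_{k-1})$ is unmatched, its state is insert$(k-1,v)$ iff $F(x_0,\ldots,x_k)=\iota(v)$, and delete$(k-1)$ iff $F(x_0,\ldots,x_k)=\delta$. $F$ is valid if: (1) whenever $F(x_0,\ldots,x_k)=\iota(v)$, we have $d(x_{k-1},v)+d(v,x_k)=d(x_{k-1},x_k)$, $F(x_0,\ldots,x_{k-1},v)=\epsilon$ and $F(x_0,\ldots,x_{k-1},v,x_k)=\delta$; (2) whenever $F(x_0,\ldots,x_k)=\delta$, we have $d(x_{k-2},x_{k-1})+d(x_{k-1},x_k)=d(x_{k-2},x_k)$ and $F(x_0,\ldots,x_{k-2},x_k)=\iota(x_{k-1})$. A valid $F$ is diagonal if $F(x_0,\ldots,x_k)\ne\epsilon$ for every sequence $(x_0,\ldots,x_k)$ with unmatched prefix $(x_0,\ldots,x_{k-1})$ and $d(x_{k-1},x_k)\ge 2$. -}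

module Defs where

open import Data.Nat using (ℕ; zero; suc; _+_; _≤_; _<_)
open import Data.Fin using (Fin)
open import Data.List using (List; []; _∷_; _++_; length; take)
open import Data.List.Relation.Unary.Linked using (Linked)
open import Data.Product using (Σ; ∃; _×_; _,_)
open import Data.Sum using (_⊎_)
open import Data.Empty using (⊥)
open import Relation.Nullary using (¬_)
open import Relation.Binary.PropositionalEquality using (_≡_)

record SimpleGraph : Set₁ where
  field
    n      : ℕ
    Adj    : Fin n → Fin n → Set
    sym    : ∀ {x y} → Adj x y → Adj y x
    irrefl : ∀ {x} → ¬ Adj x x

open SimpleGraph public

V : SimpleGraph → Set
V G = Fin (n G)

data Walk (G : SimpleGraph) : V G → V G → ℕ → Set where
  stay : ∀ {x} → Walk G x x 0
  step : ∀ {x y z m} → Adj G x z → Walk G z y m → Walk G x y (suc m)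

Connected : SimpleGraph → Set
Connected G = ∀ (x y : V G) → ∃ λ m → Walk G x y m

IsShortestPathMetric : (G : SimpleGraph) → (V G → V G → ℕ) → Set
IsShortestPathMetric G d =
  ∀ (x y : V G) → Walk G x y (d x y) × (∀ m → Walk G x y m → d x y ≤ m)

module _ {A : Set} where

  IsSeq : List A → Set
  IsSeq xs = 1 ≤ length xs × Linked (λ a b → ¬ a ≡ b) xs

  deleteAt : ℕ → List A → List A
  deleteAt _       []       = []
  deleteAt zero    (x ∷ xs) = xs
  deleteAt (suc i) (x ∷ xs) = x ∷ deleteAt i xs

  insertAt : ℕ → A → List A → List A
  insertAt zero    v xs       = v ∷ xs
  insertAt (suc j) v []       = v ∷ []
  insertAt (suc j) v (x ∷ xs) = x ∷ insertAt j v xs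

  ℓ : (A → A → ℕ) → List A → ℕ
  ℓ d (x ∷ y ∷ xs) = d x y + ℓ d (y ∷ xs)
  ℓ d _            = 0

  ΓEdge : (A → A → ℕ) → List A → List A → Set
  ΓEdge d a b = IsSeq a × IsSeq b ×
    Σ ℕ λ i → 1 ≤ i × suc i < length a × b ≡ deleteAt i a × ℓ d b ≡ ℓ d a

  -- a set of edges of Γ is represented by a relation M (M a b: edge a → b)
  IsMatching : (A → A → ℕ) → (List A → List A → Set) → Set
  IsMatching d M =
    (∀ a b → M a b → ΓEdge d a b) ×
    (∀ a b c e → M a b → M c e →
       (a ≡ c ⊎ a ≡ e ⊎ b ≡ c ⊎ b ≡ e) → a ≡ c × b ≡ e)

  Matched : (List A → List A → Set) → List A → List A → Set
  Matched M a b = M a b ⊎ M b a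

  Unmatched : (List A → List A → Set) → List A → Set
  Unmatched M a = ∀ b → ¬ Matched M a b

  -- state insert(i,v): matched to (x_0,…,x_i,v,x_{i+1},…,x_k)
  InsertState : (List A → List A → Set) → List A → ℕ → A → Set
  InsertState M a i v = suc i < length a × Matched M a (insertAt (suc i) v a)

  DeleteState : (List A → List A → Set) → List A → ℕ → Set
  DeleteState M a i = 1 ≤ i × suc i < length a × Matched M a (deleteAt i a)

  IsPrefixMatching : (A → A → ℕ) → (List A → List A → Set) → Set
  IsPrefixMatching d M = IsMatching d M ×
    (∀ a i v → InsertState M a i v →
       ∀ ys → IsSeq (take (suc (suc i)) a ++ ys) →
         InsertState M (take (suc (suc i)) a ++ ys) i v) ×
    (∀ a i → DeleteState M a i →
       ∀ ys → IsSeq (take (suc (suc i)) a ++ ys) →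
         DeleteState M (take (suc (suc i)) a ++ ys) i)

data Sym (A : Set) : Set where
  ε : Sym A
  ι : A → Sym A
  δ : Sym A

module _ {A : Set} where

  -- sequences (x_0,…,x_k) with k ≥ 1 are written ps ++ x ∷ y ∷ [],
  -- so x = x_{k-1}, y = x_k, length ps = k - 1.
  GeneratedBy : (List A → Sym A) → (List A → List A → Set) → Set
  GeneratedBy F M = ∀ ps x y → IsSeq (ps ++ x ∷ y ∷ []) →
    Unmatched M (ps ++ x ∷ []) →
      (∀ v → (InsertState M (ps ++ x ∷ y ∷ []) (length ps) v
                → F (ps ++ x ∷ y ∷ []) ≡ ι v) ×
             (F (ps ++ x ∷ y ∷ []) ≡ ι v
                → InsertState M (ps ++ x ∷ y ∷ []) (length ps) v)) ×
      ((DeleteState M (ps ++ x ∷ y ∷ []) (length ps) → F (ps ++ x ∷ y ∷ []) ≡ δ) ×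
       (F (ps ++ x ∷ y ∷ []) ≡ δ → DeleteState M (ps ++ x ∷ y ∷ []) (length ps)))

  Valid : (A → A → ℕ) → (List A → Sym A) → Set
  Valid d F =
    (∀ ps x y v → F (ps ++ x ∷ y ∷ []) ≡ ι v →
       d x v + d v y ≡ d x y ×
       F (ps ++ x ∷ v ∷ []) ≡ ε ×
       F (ps ++ x ∷ v ∷ y ∷ []) ≡ δ) ×
    (∀ ps w x y → F (ps ++ w ∷ x ∷ y ∷ []) ≡ δ →
       d w x + d x y ≡ d w y ×
       F (ps ++ w ∷ y ∷ []) ≡ ι x)

  -- diagonal, relative to the matching M (the one generated by F)
  Diagonal : (A → A → ℕ) → (List A → Sym A) → (List A → List A → Set) → Set
  Diagonal d F M = Valid d F ×
    (∀ ps x y → IsSeq (ps ++ x ∷ y ∷ []) → Unmatched M (ps ++ x ∷ []) →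
       2 ≤ d x y → ¬ F (ps ++ x ∷ y ∷ []) ≡ ε)

-- A sequence whose final step is too long (d ≥ 2) has a non-ε rule value by
-- diagonality, so if its prefix is unmatched the generated matching pairs it up.
-- Since the prefix matching propagates a matching state to every extension of
-- a long enough prefix, all prefixes of an unmatched sequence are unmatched,
-- hence each step of it has length < 2, i.e. length 1. For F(…, x, y) = ι(v),
-- validity gives F(…, x, v) = ε for the sequence (…, x, v) with unmatched
-- prefix, so diagonality forces d(x, v) < 2 as well.
module Submission where

open import Defs hiding (sym)
open import Data.Nat using (ℕ; zero; suc; _≤_; _<_; z≤n; s≤s; s≤s⁻¹)
open import Data.Nat.Properties using (<-trans; n<1+n; ≰⇒>)
open import Data.List using (List; []; _∷_; _++_; length; take; drop)
open import Data.List.Properties using (++-assoc; take++drop≡id)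
open import Data.List.Relation.Unary.Linked as Linked using (Linked; []; [-]; _∷_)
open import Data.Product using (_×_; _,_; Σ; ∃; proj₁; proj₂; uncurry)
open import Data.Sum using (_⊎_; inj₁; inj₂)
open import Relation.Nullary using (¬_; contradiction)
open import Relation.Binary.PropositionalEquality
  using (_≡_; refl; sym; trans; subst; cong)

module _ {A : Set} where

  length-deleteAt : ∀ i (xs : List A) → i < length xs →
                    length xs ≡ suc (length (deleteAt i xs))
  length-deleteAt zero    (x ∷ xs) _         = refl
  length-deleteAt (suc i) (x ∷ xs) (s≤s i<n) = cong suc (length-deleteAt i xs i<n)

  insertAt-deleteAt : ∀ i (xs : List A) → i < length xs →
                      ∃ λ w → insertAt i w (deleteAt i xs) ≡ xs
  insertAt-deleteAt zero    (x ∷ xs) _         = x , refl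
  insertAt-deleteAt (suc i) (x ∷ xs) (s≤s i<n) with insertAt-deleteAt i xs i<n
  ... | w , eq = w , cong (x ∷_) eq

  insertAt-after : ∀ (ps : List A) x v ys →
                   insertAt (suc (length ps)) v (ps ++ x ∷ ys) ≡ ps ++ x ∷ v ∷ ys
  insertAt-after []       x v ys = refl
  insertAt-after (p ∷ ps) x v ys = cong (p ∷_) (insertAt-after ps x v ys)

  take++drop++ : ∀ k (xs ys : List A) → take k xs ++ (drop k xs ++ ys) ≡ xs ++ ys
  take++drop++ k xs ys = trans (sym (++-assoc (take k xs) (drop k xs) ys))
                               (cong (_++ ys) (take++drop≡id k xs))

  length-++-∷ : ∀ (ps : List A) x ys → 1 ≤ length (ps ++ x ∷ ys)
  length-++-∷ []      x ys = s≤s z≤n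
  length-++-∷ (_ ∷ _) x ys = s≤s z≤n

  module _ {R : A → A → Set} where

    Linked-++⁻ˡ : ∀ xs {ys} → Linked R (xs ++ ys) → Linked R xs
    Linked-++⁻ˡ []           _         = []
    Linked-++⁻ˡ (x ∷ [])     _         = [-]
    Linked-++⁻ˡ (x ∷ y ∷ xs) (r ∷ rs) = r ∷ Linked-++⁻ˡ (y ∷ xs) rs

    Linked-adjacent : ∀ ps {x y ys} → Linked R (ps ++ x ∷ y ∷ ys) → R x y
    Linked-adjacent []           (r ∷ _)  = r
    Linked-adjacent (_ ∷ [])     (_ ∷ rs) = Linked-adjacent [] rs
    Linked-adjacent (_ ∷ q ∷ ps) (_ ∷ rs) = Linked-adjacent (q ∷ ps) rs

    adjacent⇒Linked : ∀ xs → (∀ ps x y ys → ps ++ x ∷ y ∷ ys ≡ xs → R x y) →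
                      Linked R xs
    adjacent⇒Linked []           _   = []
    adjacent⇒Linked (x ∷ [])     _   = [-]
    adjacent⇒Linked (x ∷ y ∷ xs) adj =
      adj [] x y xs refl ∷
      adjacent⇒Linked (y ∷ xs) (λ ps a b ys eq → adj (x ∷ ps) a b ys (cong (x ∷_) eq))

  IsSeq-upTo : ∀ ps x y ys → IsSeq (ps ++ x ∷ y ∷ ys) → IsSeq (ps ++ x ∷ y ∷ [])
  IsSeq-upTo ps x y ys (_ , linked) =
    length-++-∷ ps x (y ∷ []) ,
    Linked-++⁻ˡ (ps ++ x ∷ y ∷ [])
      (subst (Linked _) (sym (++-assoc ps (x ∷ y ∷ []) ys)) linked)

  HasState : (List A → List A → Set) → List A → Set
  HasState M a = (Σ ℕ λ i → Σ A λ v → InsertState M a i v) ⊎ (Σ ℕ λ i → DeleteState M a i)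

  state⇒matched : ∀ {M a} → HasState M a → ∃ (Matched M a)
  state⇒matched (inj₁ (_ , _ , _ , m)) = _ , m
  state⇒matched (inj₂ (_ , _ , _ , m)) = _ , m

  module _ {d : A → A → ℕ} {M : List A → List A → Set} where

    module _ (matching : IsMatching d M) where

      matched⇒IsSeq : ∀ {a b} → Matched M a b → IsSeq b
      matched⇒IsSeq (inj₁ m) = proj₁ (proj₂ (proj₁ matching _ _ m))
      matched⇒IsSeq (inj₂ m) = proj₁ (proj₁ matching _ _ m)

      matched⇒state : ∀ {a b} → Matched M a b → HasState M a
      matched⇒state {a} (inj₁ m) with proj₁ matching _ _ m
      ... | _ , _ , i , 1≤i , i<n , eq , _ =
        inj₂ (i , 1≤i , i<n , inj₁ (subst (M a) eq m))
      matched⇒state {b = b} (inj₂ m) with proj₁ matching _ _ m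
      ... | _ , _ , suc i , _ , i+1<n , refl , _
        with insertAt-deleteAt (suc i) b (<-trans (n<1+n _) i+1<n)
      ... | w , eq =
        inj₁ (i , w , i<length ,
              inj₂ (subst (λ c → M c (deleteAt (suc i) b)) (sym eq) m))
        where
        i<length : suc i < length (deleteAt (suc i) b)
        i<length = s≤s⁻¹ (subst (suc (suc i) <_)
                                (length-deleteAt (suc i) b (<-trans (n<1+n _) i+1<n)) i+1<n)

    module _ (prefix : IsPrefixMatching d M) where

      -- A state insert(i, v) or delete(i) depends only on the entries up to x_{i+1}.
      HasState-++⁺ : ∀ xs ys → IsSeq (xs ++ ys) → HasState M xs → HasState M (xs ++ ys)
      HasState-++⁺ xs ys seq (inj₁ (i , v , st)) =
        subst (HasState M) (take++drop++ (suc (suc i)) xs ys)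
          (inj₁ (i , v , proj₁ (proj₂ prefix) xs i v st _
                           (subst IsSeq (sym (take++drop++ (suc (suc i)) xs ys)) seq)))
      HasState-++⁺ xs ys seq (inj₂ (i , st)) =
        subst (HasState M) (take++drop++ (suc (suc i)) xs ys)
          (inj₂ (i , proj₂ (proj₂ prefix) xs i st _
                       (subst IsSeq (sym (take++drop++ (suc (suc i)) xs ys)) seq)))

      Unmatched-++⁻ˡ : ∀ xs ys → IsSeq (xs ++ ys) → Unmatched M (xs ++ ys) →
                       Unmatched M xs
      Unmatched-++⁻ˡ xs ys seq unmatched _ m =
        uncurry unmatched
          (state⇒matched {M = M} (HasState-++⁺ xs ys seq (matched⇒state (proj₁ prefix) m)))

module _ {A : Set} {F : List A → Sym A} {M : List A → List A → Set}
         (generated : GeneratedBy F M) where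

  unmatched⇒rule≡ε : ∀ ps x y → IsSeq (ps ++ x ∷ y ∷ []) → Unmatched M (ps ++ x ∷ []) →
                     Unmatched M (ps ++ x ∷ y ∷ []) → F (ps ++ x ∷ y ∷ []) ≡ ε
  unmatched⇒rule≡ε ps x y seq unmatched-prefix unmatched
    with F (ps ++ x ∷ y ∷ []) | generated ps x y seq unmatched-prefix
  ... | ε   | _              = refl
  ... | ι v | insert , _     =
    contradiction (state⇒matched {M = M} (inj₁ (_ , v , proj₂ (insert v) refl)))
                  (uncurry unmatched)
  ... | δ   | _ , _ , delete =
    contradiction (state⇒matched {M = M} (inj₂ (_ , delete refl))) (uncurry unmatched)

  module _ {d : A → A → ℕ} (diagonal : Diagonal d F M) where

    rule≡ε⇒step<2 : ∀ ps x y → IsSeq (ps ++ x ∷ y ∷ []) → Unmatched M (ps ++ x ∷ []) →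
                    F (ps ++ x ∷ y ∷ []) ≡ ε → d x y < 2
    rule≡ε⇒step<2 ps x y seq unmatched-prefix rule =
      ≰⇒> (λ 2≤d → proj₂ diagonal ps x y seq unmatched-prefix 2≤d rule)

    unmatched⇒steps<2 : IsPrefixMatching d M → ∀ xs → IsSeq xs → Unmatched M xs →
                        Linked (λ a b → d a b < 2) xs
    unmatched⇒steps<2 prefix xs seq unmatched = adjacent⇒Linked xs step<2
      where
      step<2 : ∀ ps x y ys → ps ++ x ∷ y ∷ ys ≡ xs → d x y < 2
      step<2 ps x y ys refl =
        rule≡ε⇒step<2 ps x y seq-upTo unmatched-upTo-x
          (unmatched⇒rule≡ε ps x y seq-upTo unmatched-upTo-x unmatched-upTo-y)
        where
        seq-upTo : IsSeq (ps ++ x ∷ y ∷ [])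
        seq-upTo = IsSeq-upTo ps x y ys seq
        unmatched-prefix : ∀ zs zs′ → zs ++ zs′ ≡ ps ++ x ∷ y ∷ ys → Unmatched M zs
        unmatched-prefix zs zs′ eq =
          Unmatched-++⁻ˡ prefix zs zs′ (subst IsSeq (sym eq) seq)
                                       (subst (Unmatched M) (sym eq) unmatched)
        unmatched-upTo-y : Unmatched M (ps ++ x ∷ y ∷ [])
        unmatched-upTo-y = unmatched-prefix _ ys (++-assoc ps (x ∷ y ∷ []) ys)
        unmatched-upTo-x : Unmatched M (ps ++ x ∷ [])
        unmatched-upTo-x = unmatched-prefix _ (y ∷ ys) (++-assoc ps (x ∷ []) (y ∷ ys))

    -- The rule's insertion (…, x, v, y) is an actual sequence, and its prefix
    -- (…, x, v) has rule value ε by validity.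
    insertion-step<2 : IsMatching d M → ∀ ps x y v → IsSeq (ps ++ x ∷ y ∷ []) →
                     Unmatched M (ps ++ x ∷ []) → F (ps ++ x ∷ y ∷ []) ≡ ι v →
                     ¬ x ≡ v × d x v < 2
    insertion-step<2 matching ps x y v seq unmatched-prefix rule =
      Linked-adjacent ps (proj₂ seq-inserted) ,
      rule≡ε⇒step<2 ps x v (IsSeq-upTo ps x v (y ∷ []) seq-inserted) unmatched-prefix
        (proj₁ (proj₂ (proj₁ (proj₁ diagonal) ps x y v rule)))
      where
      seq-inserted : IsSeq (ps ++ x ∷ v ∷ y ∷ [])
      seq-inserted =
        subst IsSeq (insertAt-after ps x v (y ∷ []))
          (matched⇒IsSeq matching
            (proj₂ (proj₂ (proj₁ (generated ps x y seq unmatched-prefix) v) rule)))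

shortestPath-distance≡1 : ∀ G {d} → IsShortestPathMetric G d →
             ∀ {x y} → ¬ x ≡ y → d x y < 2 → d x y ≡ 1
shortestPath-distance≡1 G {d} metric {x} {y} x≢y d<2 with d x y | proj₁ (metric x y)
... | zero          | stay = contradiction refl x≢y
... | suc zero      | _    = refl
... | suc (suc _)   | _    = contradiction d<2 λ { (s≤s (s≤s ())) }

lemma3p9 : (G : SimpleGraph) → Connected G →
    (d : V G → V G → ℕ) → IsShortestPathMetric G d →
    (F : List (V G) → Sym (V G)) → (M : List (V G) → List (V G) → Set) →
    IsPrefixMatching d M → GeneratedBy F M → Diagonal d F M →
    (∀ (xs : List (V G)) → IsSeq xs → Unmatched M xs →
    Linked (λ a b → d a b ≡ 1) xs) ×
    (∀ (ps : List (V G)) (x y v : V G) → IsSeq (ps ++ x ∷ y ∷ []) →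
    Unmatched M (ps ++ x ∷ []) → F (ps ++ x ∷ y ∷ []) ≡ ι v →
    d x v ≡ 1)
lemma3p9 G _ d metric F M prefix generated diagonal =
  (λ xs seq unmatched →
     Linked.zipWith (uncurry (shortestPath-distance≡1 G metric))
       (proj₂ seq , unmatched⇒steps<2 {F = F} generated diagonal prefix xs seq unmatched)) ,
  (λ ps x y v seq unmatched-prefix rule →
     uncurry (shortestPath-distance≡1 G metric)
       (insertion-step<2 {F = F} generated diagonal (proj₁ prefix) ps x y v seq unmatched-prefix rule))
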